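{- Let $N$ be a Nov\'ak number and let $p_1,\ldots,p_k$ be prime factors of $2^N+1$. Then for any nonnegative integers $\alpha_1,\ldots,\alpha_k$ the number $Np_1^{\alpha_1}\cdots p_k^{\alpha_k}$ is a Nov\'ak number.
   Context: A Nov\'ak number is a positive integer $N$ with $N\mid 2^N+1$. -}

module Defs where

open import Data.Nat using (ℕ; zero; suc; _+_; _*_; _^_; _>_)
open import Data.Nat.Divisibility using (_∣_)
open import Data.Fin using (Fin)
open import Data.Product using (_×_)

IsNovak : ℕ → Set
IsNovak N = (N > 0) × (N ∣ 2 ^ N + 1)

∏ : (k : ℕ) → (Fin k → ℕ) → ℕ
∏ zero    f = 1
∏ (suc k) f = f Fin.zero * ∏ k (λ i → f (Fin.suc i))

-- Let M be a Novák number and d ∣ 2 ^ M + 1; then d is odd. Put a = 2 ^ M and expand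
-- a ^ d = ((a + 1) - 1) ^ d binomially: a ^ d + 1 ≡ d (a + 1) modulo (a + 1) ^ 2, and as
-- d ∣ a + 1 this gives (a + 1) d ∣ a ^ d + 1 = 2 ^ (M d) + 1. Hence M d is again a Novák
-- number and 2 ^ M + 1 ∣ 2 ^ (M d) + 1. The second fact keeps every divisor of 2 ^ N + 1 a
-- divisor of 2 ^ M + 1, so the prime factors can be multiplied onto N one at a time.
{-# OPTIONS --safe #-}
module Submission where

open import Defs
open import Data.Fin as Fin using (Fin)
open import Data.Integer.Tactic.RingSolver using (solve)
open import Data.List using (_∷_; [])
open import Data.Nat.Divisibility
  using (_∣_; divides; ∣-refl; ∣-trans; ∣1⇒≡1; ∣m+n∣m⇒∣n; m∣m*n; *-monoˡ-∣)
open import Data.Nat.Primality using (Prime)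
import Data.Nat as ℕ
import Data.Nat.Properties as ℕ
import Data.Integer as ℤ
import Data.Integer.Properties as ℤ
open import Data.Product using (_×_; _,_; proj₁; ∃-syntax)
open import Data.Sum using (_⊎_; inj₁; inj₂)
open import Relation.Nullary using (¬_)
open import Relation.Binary.PropositionalEquality
  using (_≡_; refl; sym; trans; cong; subst; module ≡-Reasoning)

module _ where
  open import Data.Nat using (zero; suc)
  open import Data.Integer using (+_; 0ℤ; 1ℤ; _+_; _-_; _*_; _^_)
  open ≡-Reasoning

  pow+1-expansion-step : ∀ x y n k → y + 1ℤ ≡ n * (x + 1ℤ) + (x + 1ℤ) * (x + 1ℤ) * k →
    x * (x * y) + 1ℤ ≡ (+ 2 + n) * (x + 1ℤ) + (x + 1ℤ) * (x + 1ℤ) * (x * x * k + n * (x - 1ℤ) - 1ℤ)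
  pow+1-expansion-step x y n k eq = begin
    x * (x * y) + 1ℤ
      ≡⟨ solve (x ∷ y ∷ []) ⟩
    x * x * (y + 1ℤ) - (x - 1ℤ) * (x + 1ℤ)
      ≡⟨ cong (λ z → x * x * z - (x - 1ℤ) * (x + 1ℤ)) eq ⟩
    x * x * (n * (x + 1ℤ) + (x + 1ℤ) * (x + 1ℤ) * k) - (x - 1ℤ) * (x + 1ℤ)
      ≡⟨ solve (x ∷ n ∷ k ∷ []) ⟩
    (+ 2 + n) * (x + 1ℤ) + (x + 1ℤ) * (x + 1ℤ) * (x * x * k + n * (x - 1ℤ) - 1ℤ) ∎

  odd-pow+1-expansion : ∀ x j → let n = suc (j ℕ.* 2) in
    ∃[ k ] x ^ n + 1ℤ ≡ + n * (x + 1ℤ) + (x + 1ℤ) * (x + 1ℤ) * k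
  odd-pow+1-expansion x zero    = 0ℤ , base
    where base : x * 1ℤ + 1ℤ ≡ 1ℤ * (x + 1ℤ) + (x + 1ℤ) * (x + 1ℤ) * 0ℤ
          base = solve (x ∷ [])
  odd-pow+1-expansion x (suc j) with odd-pow+1-expansion x j
  ... | k , eq = _ , pow+1-expansion-step x (x ^ suc (j ℕ.* 2)) (+ suc (j ℕ.* 2)) k eq

  pow+1-factorisation : ∀ x y n t k → y + 1ℤ ≡ n * (x + 1ℤ) + (x + 1ℤ) * (x + 1ℤ) * k →
    x + 1ℤ ≡ t * n → y + 1ℤ ≡ (x + 1ℤ) * n * (1ℤ + t * k)
  pow+1-factorisation x y n t k eq x+1≡tn = begin
    y + 1ℤ                                             ≡⟨ eq ⟩
    n * (x + 1ℤ) + (x + 1ℤ) * (x + 1ℤ) * k             ≡⟨ cong (λ z → n * (x + 1ℤ) + (x + 1ℤ) * z * k) x+1≡tn ⟩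
    n * (x + 1ℤ) + (x + 1ℤ) * (t * n) * k             ≡⟨ solve (x ∷ n ∷ t ∷ k ∷ []) ⟩
    (x + 1ℤ) * n * (1ℤ + t * k)                        ∎

  odd-pow+1-factorisation : ∀ x t j → let n = suc (j ℕ.* 2) in
    x + 1ℤ ≡ t * + n → ∃[ c ] x ^ n + 1ℤ ≡ (x + 1ℤ) * + n * c
  odd-pow+1-factorisation x t j x+1≡tn with odd-pow+1-expansion x j
  ... | k , eq = 1ℤ + t * k , pow+1-factorisation x (x ^ suc (j ℕ.* 2)) (+ suc (j ℕ.* 2)) t k eq x+1≡tn

open import Data.Nat using (ℕ; zero; suc; _+_; _*_; _^_; z<s)
open import Data.Integer using (+_; 1ℤ; ∣_∣)

pos-^ : ∀ a n → + (a ^ n) ≡ (+ a) ℤ.^ n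
pos-^ a zero    = refl
pos-^ a (suc n) = trans (ℤ.pos-* a (a ^ n)) (cong (+ a ℤ.*_) (pos-^ a n))

odd-∣⇒*-∣-pow+1 : ∀ a j → let n = suc (j * 2) in n ∣ a + 1 → (a + 1) * n ∣ a ^ n + 1
odd-∣⇒*-∣-pow+1 a j (divides t a+1≡tn)
  with odd-pow+1-factorisation (+ a) (+ t) j (trans (cong +_ a+1≡tn) (ℤ.pos-* t (suc (j * 2))))
... | c , eq = divides ∣ c ∣ (begin
  a ^ n + 1                      ≡⟨ cong (λ z → ∣ z ℤ.+ 1ℤ ∣) (pos-^ a n) ⟩
  ∣ (+ a) ℤ.^ n ℤ.+ 1ℤ ∣          ≡⟨ cong ∣_∣ eq ⟩
  ∣ + (a + 1) ℤ.* + n ℤ.* c ∣     ≡⟨ ℤ.abs-* (+ (a + 1) ℤ.* + n) c ⟩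
  ∣ + (a + 1) ℤ.* + n ∣ * ∣ c ∣   ≡⟨ cong (_* ∣ c ∣) (ℤ.abs-* (+ (a + 1)) (+ n)) ⟩
  (a + 1) * n * ∣ c ∣             ≡⟨ ℕ.*-comm ((a + 1) * n) ∣ c ∣ ⟩
  ∣ c ∣ * ((a + 1) * n)           ∎)
  where
  open ≡-Reasoning
  n = suc (j * 2)

even⊎odd : ∀ n → (∃[ j ] n ≡ j * 2) ⊎ (∃[ j ] n ≡ suc (j * 2))
even⊎odd zero    = inj₁ (0 , refl)
even⊎odd (suc n) with even⊎odd n
... | inj₁ (j , refl) = inj₂ (j , refl)
... | inj₂ (j , refl) = inj₁ (suc j , refl)

2∤2^suc+1 : ∀ m → ¬ 2 ∣ 2 ^ suc m + 1
2∤2^suc+1 m 2∣ with ∣1⇒≡1 (∣m+n∣m⇒∣n 2∣ (divides (2 ^ m) (ℕ.*-comm 2 (2 ^ m))))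
... | ()

∣2^suc+1⇒odd : ∀ m {d} → d ∣ 2 ^ suc m + 1 → ∃[ j ] d ≡ suc (j * 2)
∣2^suc+1⇒odd m {d} d∣ with even⊎odd d
... | inj₂ odd          = odd
... | inj₁ (j , refl) with 2∤2^suc+1 m (∣-trans (divides j refl) d∣)
...   | ()

novak-*-divisor : ∀ {M d} → IsNovak M → d ∣ 2 ^ M + 1 →
  IsNovak (M * d) × (2 ^ M + 1 ∣ 2 ^ (M * d) + 1)
novak-*-divisor {suc m} {d} (_ , M∣) d∣ with ∣2^suc+1⇒odd m d∣
... | j , refl = (z<s , ∣-trans (*-monoˡ-∣ d M∣) a+1*d∣) , ∣-trans (m∣m*n d) a+1*d∣
  where
  a+1*d∣ : (2 ^ suc m + 1) * d ∣ 2 ^ (suc m * d) + 1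
  a+1*d∣ = subst (λ e → (2 ^ suc m + 1) * d ∣ e + 1) (ℕ.^-*-assoc 2 (suc m) d)
                 (odd-∣⇒*-∣-pow+1 (2 ^ suc m) j d∣)

module MultiplicativelyClosed (P : ℕ → Set) (P-1 : P 1) (P-* : ∀ {m n} → P m → P n → P (m * n)) where

  ^-closed : ∀ {m} n → P m → P (m ^ n)
  ^-closed zero    _  = P-1
  ^-closed (suc n) Pm = P-* Pm (^-closed n Pm)

  ∏-closed : ∀ k (f : Fin k → ℕ) → (∀ i → P (f i)) → P (∏ k f)
  ∏-closed zero    f Pf = P-1
  ∏-closed (suc k) f Pf = P-* (Pf Fin.zero) (∏-closed k (λ i → f (Fin.suc i)) (λ i → Pf (Fin.suc i)))

NovakOver : ℕ → ℕ → Set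
NovakOver N M = IsNovak M × (2 ^ N + 1 ∣ 2 ^ M + 1)

NovakMultiplier : ℕ → ℕ → Set
NovakMultiplier N m = ∀ {M} → NovakOver N M → NovakOver N (M * m)

1-novakMultiplier : ∀ {N} → NovakMultiplier N 1
1-novakMultiplier {N} {M} = subst (NovakOver N) (sym (ℕ.*-identityʳ M))

*-novakMultiplier : ∀ {N m n} → NovakMultiplier N m → NovakMultiplier N n → NovakMultiplier N (m * n)
*-novakMultiplier {N} {m} {n} m-mult n-mult {M} over =
  subst (NovakOver N) (ℕ.*-assoc M m n) (n-mult (m-mult over))

∣2^+1⇒novakMultiplier : ∀ {N d} → d ∣ 2 ^ N + 1 → NovakMultiplier N d
∣2^+1⇒novakMultiplier d∣ (novak , N∣M) with novak-*-divisor novak (∣-trans d∣ N∣M)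
... | novak′ , M∣Md = novak′ , ∣-trans N∣M M∣Md

lemma5 : (N : ℕ) → IsNovak N → (k : ℕ) → (p : Fin k → ℕ)
    → (∀ i → Prime (p i)) → (∀ i → p i ∣ 2 ^ N + 1)
    → (α : Fin k → ℕ) → IsNovak (N * ∏ k (λ i → p i ^ α i))
lemma5 N novak k p _ p∣ α = proj₁ (multiplier (novak , ∣-refl))
  where
  multiplier : NovakMultiplier N (∏ k (λ i → p i ^ α i))
  multiplier = ∏-closed k _ λ i → ^-closed (α i) (∣2^+1⇒novakMultiplier {N} (p∣ i))
    where open MultiplicativelyClosed (NovakMultiplier N) (1-novakMultiplier {N}) (*-novakMultiplier {N})
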